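{- Let $(G,F)$ be a framed graph, let $R_1$ be a route in a maximal clique $C_1$, and let $R_2$ be a route with $R_1<_v^{cw}R_2$ for some vertex $v$. Then $C_2=(C_1\setminus\{R_1\})\cup\{R_2\}$ is a maximal clique if and only if both of the following hold: (i) the routes $R_1vR_2$ and $R_2vR_1$ are contained in $C_1\cap C_2$; (ii) no route in $C_1$ is in between $R_1$ and $R_2$ at $v$.
   Context: A flow graph $G$ is a finite directed acyclic multigraph with linearly ordered vertices, edges directed from smaller to larger vertices, a unique source $s$ and unique sink $t$; a route is a directed $s$–$t$ path. A framing $F$ gives at each vertex $v$ linear orders $\le_{\mathrm{In}(v)}$, $\le_{\mathrm{Out}(v)}$ on entering and leaving edges. For a path $P$ through $v$, $Pv$ (resp. $vP$) is the maximal subpath of $P$ ending (resp. starting) at $v$. For $Pv,Qv$, let $w$ be the first vertex after which they coincide; if $w$ is the first vertex of one of them they are equal, else $Pv<_{\mathscr I(v)}Qv$ iff $P$'s edge entering $w$ precedes $Q$'s in $\le_{\mathrm{In}(w)}$. Dually for $vP,vQ$ with $w'$ the last vertex before which they coincide, using $\le_{\mathrm{Out}(w')}$, giving $<_{\mathscr O(v)}$ (and $\le$ versions allowing equality). For paths $P,Q$ with common inner vertex $v$, $P<_v^{cw}Q$ means $Pv<_{\mathscr I(v)}Qv$ and $vQ<_{\mathscr O(v)}vP$; they are incoherent at $v$ if $P<_v^{cw}Q$ or $Q<_v^{cw}P$, coherent if incoherent at no common inner vertex. A clique is a set of pairwise coherent routes; maximal cliques are maximal under inclusion. $RvR'$ denotes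 the route $Rv$ followed by $vR'$. If $R_1<_v^{cw}R_2$, a route $R$ is in between $R_1$ and $R_2$ at $v$ if either ($R_1v<_{\mathscr I(v)}Rv<_{\mathscr I(v)}R_2v$ and $vR_2\le_{\mathscr O(v)}vR\le_{\mathscr O(v)}vR_1$) or ($R_1v\le_{\mathscr I(v)}Rv\le_{\mathscr I(v)}R_2v$ and $vR_2<_{\mathscr O(v)}vR<_{\mathscr O(v)}vR_1$). -}

module Defs where

open import Level using (0ℓ)
open import Data.Nat using (ℕ)
open import Data.Fin using (Fin; _≟_) renaming (_<_ to _<ᶠ_)
open import Data.List using (List; []; _∷_; _++_; reverse)
open import Data.List.Relation.Unary.Any using (Any)
open import Data.Product using (Σ; _×_; ∃)
open import Data.Sum using (_⊎_)
open import Data.Empty using (⊥)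
open import Relation.Nullary using (¬_; yes; no)
open import Relation.Unary using (Pred; _⊆_; _∈_)
open import Relation.Binary.PropositionalEquality using (_≡_; _≢_)

-- Flow graphs: vertices Fin n (linearly ordered), edges Fin m (multigraph),
-- every edge goes from a smaller to a larger vertex (hence acyclic),
-- unique source s (the only vertex without entering edges) and
-- unique sink t (the only vertex without leaving edges).

record FlowGraph : Set where
  field
    n m        : ℕ
    src tgt    : Fin m → Fin n
    increasing : ∀ e → src e <ᶠ tgt e
    s t        : Fin n
    s-source   : ∀ e → tgt e ≢ s
    s-unique   : ∀ v → (∀ e → tgt e ≢ v) → v ≡ s
    t-sink     : ∀ e → src e ≢ t
    t-unique   : ∀ v → (∀ e → src e ≢ v) → v ≡ t

module _ (G : FlowGraph) where
  open FlowGraph G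

  Vertex : Set
  Vertex = Fin n

  Edge : Set
  Edge = Fin m

  record Framing : Set₁ where
    field
      _≤ᵢ_      : Edge → Edge → Set
      ≤ᵢ-local  : ∀ {a b} → a ≤ᵢ b → tgt a ≡ tgt b
      ≤ᵢ-refl   : ∀ a → a ≤ᵢ a
      ≤ᵢ-antisym : ∀ {a b} → a ≤ᵢ b → b ≤ᵢ a → a ≡ b
      ≤ᵢ-trans  : ∀ {a b c} → a ≤ᵢ b → b ≤ᵢ c → a ≤ᵢ c
      ≤ᵢ-total  : ∀ a b → tgt a ≡ tgt b → a ≤ᵢ b ⊎ b ≤ᵢ a
      _≤ₒ_      : Edge → Edge → Set
      ≤ₒ-local  : ∀ {a b} → a ≤ₒ b → src a ≡ src b
      ≤ₒ-refl   : ∀ a → a ≤ₒ a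
      ≤ₒ-antisym : ∀ {a b} → a ≤ₒ b → b ≤ₒ a → a ≡ b
      ≤ₒ-trans  : ∀ {a b c} → a ≤ₒ b → b ≤ₒ c → a ≤ₒ c
      ≤ₒ-total  : ∀ a b → src a ≡ src b → a ≤ₒ b ⊎ b ≤ₒ a

  data IsPath : Vertex → List Edge → Vertex → Set where
    nil  : ∀ {u} → IsPath u [] u
    cons : ∀ {u w e es} → src e ≡ u → IsPath (tgt e) es w → IsPath u (e ∷ es) w

  Route : Set
  Route = List Edge

  IsRoute : Route → Set
  IsRoute R = IsPath s R t

  Inner : Vertex → Route → Set
  Inner v R = Any (λ e → tgt e ≡ v) R × v ≢ t

  pre : Vertex → Route → List Edge
  pre v [] = []
  pre v (e ∷ es) with tgt e ≟ v
  ... | yes _ = e ∷ []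
  ... | no  _ = e ∷ pre v es

  suf : Vertex → Route → List Edge
  suf v [] = []
  suf v (e ∷ es) with tgt e ≟ v
  ... | yes _ = es
  ... | no  _ = suf v es

  -- RvR' : the route Rv followed by vR'.
  _⟨_⟩_ : Route → Vertex → Route → Route
  R ⟨ v ⟩ R' = pre v R ++ suf v R'

  module _ (F : Framing) where
    open Framing F

    _<ᵢ_ : Edge → Edge → Set
    a <ᵢ b = a ≤ᵢ b × a ≢ b

    _<ₒ_ : Edge → Edge → Set
    a <ₒ b = a ≤ₒ b × a ≢ b

    -- Comparison of two paths ending at the same vertex, given by their
    -- edge lists read backwards from that vertex: skip the common final
    -- part; at the first vertex w (going back) where they differ, compare
    -- the entering edges in ≤In(w). If they coincide up to the first vertex
    -- of one of them, they are not strictly comparable.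
    data BackLt : List Edge → List Edge → Set where
      here  : ∀ {a b as bs} → a <ᵢ b → BackLt (a ∷ as) (b ∷ bs)
      there : ∀ {a as bs} → BackLt as bs → BackLt (a ∷ as) (a ∷ bs)

    data FwdLt : List Edge → List Edge → Set where
      here  : ∀ {a b as bs} → a <ₒ b → FwdLt (a ∷ as) (b ∷ bs)
      there : ∀ {a as bs} → FwdLt as bs → FwdLt (a ∷ as) (a ∷ bs)

    _<I[_]_ : Route → Vertex → Route → Set
    P <I[ v ] Q = BackLt (reverse (pre v P)) (reverse (pre v Q))

    _<O[_]_ : Route → Vertex → Route → Set
    P <O[ v ] Q = FwdLt (suf v P) (suf v Q)

    _≤I[_]_ : Route → Vertex → Route → Set
    P ≤I[ v ] Q = P <I[ v ] Q ⊎ pre v P ≡ pre v Q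

    _≤O[_]_ : Route → Vertex → Route → Set
    P ≤O[ v ] Q = P <O[ v ] Q ⊎ suf v P ≡ suf v Q

    CW : Route → Vertex → Route → Set
    CW P v Q = Inner v P × Inner v Q × P <I[ v ] Q × Q <O[ v ] P

    Incoherent : Route → Route → Vertex → Set
    Incoherent P Q v = CW P v Q ⊎ CW Q v P

    Coherent : Route → Route → Set
    Coherent P Q = ∀ v → ¬ Incoherent P Q v

    IsClique : Pred Route 0ℓ → Set
    IsClique C = (∀ R → R ∈ C → IsRoute R) × (∀ R R' → R ∈ C → R' ∈ C → Coherent R R')

    IsMaximalClique : Pred Route 0ℓ → Set₁
    IsMaximalClique C = IsClique C × (∀ D → IsClique D → C ⊆ D → D ⊆ C)

    InBetween : Route → Route → Vertex → Route → Set
    InBetween R₁ R₂ v R =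
      Inner v R ×
      ((R₁ <I[ v ] R × R <I[ v ] R₂ × R₂ ≤O[ v ] R × R ≤O[ v ] R₁)
       ⊎ (R₁ ≤I[ v ] R × R ≤I[ v ] R₂ × R₂ <O[ v ] R × R <O[ v ] R₁))

  exchange : Pred Route 0ℓ → Route → Route → Pred Route 0ℓ
  exchange C R₁ R₂ R = (R ∈ C × R ≢ R₁) ⊎ R ≡ R₂

-- If P and Q are incoherent at v, every route Z coherent with both is coherent with the splice
-- P ⟨ v ⟩ Q: an incoherence of Z with a route can be pushed along a segment the route shares with
-- another route until it is either an incoherence with that route or sits at the junction v, where
-- the opposite orders of P and Q exclude it.
-- Now let R₂ be coherent with every route of the maximal clique C₁ other than R₁. By induction over
-- the incoherence vertices x of R₁ and R₂, the splices R₁ ⟨ x ⟩ R₂ and R₂ ⟨ x ⟩ R₁ are coherent with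
-- R₁ as well, hence lie in C₁; a route of C₁ in between R₁ and R₂ at v would be incoherent with R₁
-- or with R₂. Conversely, given (i) and (ii), an incoherence of a
-- route of C₁ ∖ {R₁} with R₂, or of a route coherent with C₂ with R₁, is pushed to v, where comparing
-- the route with R₁ and R₂ makes it, or one of its splices with R₁, incoherent with R₁ ⟨ v ⟩ R₂ or
-- R₂ ⟨ v ⟩ R₁ or in between R₁ and R₂.

module Submission where

open import Level using (0ℓ)
open import Function.Base using (_∘_)
open import Function.Bundles using (_⇔_; mk⇔)
open import Data.Product using (_×_; ∃; _,_; proj₁; proj₂)
import Data.Product as Product
open import Data.Sum using (_⊎_; inj₁; inj₂; [_,_]′)
import Data.Sum as Sum
open import Data.Empty using (⊥; ⊥-elim)
open import Data.Fin using (_≟_; _<_; _≤_)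
import Data.Fin.Properties as Fin
open import Data.Fin.Induction using (>-wellFounded; <-wellFounded)
import Data.Nat.Properties as ℕ
open import Data.List using (List; []; _∷_; _++_; reverse)
import Data.List.Properties as List
open import Data.List.Relation.Unary.Any using (Any; here; there)
import Data.List.Relation.Unary.Any.Properties as Any
open import Induction.WellFounded using (module All)
open import Relation.Nullary using (¬_; yes; no)
open import Relation.Unary using (Pred; _∈_; _⊆_)
open import Relation.Binary.PropositionalEquality
import Defs
open Defs using (nil; cons; here; there)

module Splicing (G : Defs.FlowGraph) where
  open Defs.FlowGraph G

  Vertex Edge Route : Set
  Vertex = Defs.Vertex G
  Edge   = Defs.Edge G
  Route  = Defs.Route G

  pre suf : Vertex → List Edge → List Edge
  pre = Defs.pre G
  suf = Defs.suf G

  _⟨_⟩_ : Route → Vertex → Route → Route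
  _⟨_⟩_ = Defs._⟨_⟩_ G

  IsPath : Vertex → List Edge → Vertex → Set
  IsPath = Defs.IsPath G

  IsRoute : Route → Set
  IsRoute = Defs.IsRoute G

  Inner : Vertex → Route → Set
  Inner = Defs.Inner G

  infix 4 _∈ᵥ_
  _∈ᵥ_ : Vertex → List Edge → Set
  v ∈ᵥ xs = Any (λ e → tgt e ≡ v) xs

  pre++suf : ∀ v xs → pre v xs ++ suf v xs ≡ xs
  pre++suf v [] = refl
  pre++suf v (e ∷ es) with tgt e ≟ v
  ... | yes _ = refl
  ... | no  _ = cong (e ∷_) (pre++suf v es)

  ∈ᵥ-pre⊎suf : ∀ {u} v xs → u ∈ᵥ xs → u ∈ᵥ pre v xs ⊎ u ∈ᵥ suf v xs
  ∈ᵥ-pre⊎suf v xs u∈ = Any.++⁻ (pre v xs) (subst (_ ∈ᵥ_) (sym (pre++suf v xs)) u∈)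

  ∈ᵥ-pre⇒∈ᵥ : ∀ {u} v xs → u ∈ᵥ pre v xs → u ∈ᵥ xs
  ∈ᵥ-pre⇒∈ᵥ v xs u∈ = subst (_ ∈ᵥ_) (pre++suf v xs) (Any.++⁺ˡ u∈)

  ∈ᵥ-suf⇒∈ᵥ : ∀ {u} v xs → u ∈ᵥ suf v xs → u ∈ᵥ xs
  ∈ᵥ-suf⇒∈ᵥ v xs u∈ = subst (_ ∈ᵥ_) (pre++suf v xs) (Any.++⁺ʳ (pre v xs) u∈)

  ∈ᵥ-pre : ∀ {v} xs → v ∈ᵥ xs → v ∈ᵥ pre v xs
  ∈ᵥ-pre {v} (e ∷ es) v∈ with tgt e ≟ v
  ∈ᵥ-pre (e ∷ es) v∈         | yes e↦v = here e↦v
  ∈ᵥ-pre (e ∷ es) (here e↦v) | no ¬e↦v = ⊥-elim (¬e↦v e↦v)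
  ∈ᵥ-pre (e ∷ es) (there v∈) | no _    = there (∈ᵥ-pre es v∈)

  pre-idem : ∀ v xs → pre v (pre v xs) ≡ pre v xs
  pre-idem v [] = refl
  pre-idem v (e ∷ es) with tgt e ≟ v
  ... | yes e↦v with tgt e ≟ v
  ...   | yes _    = refl
  ...   | no ¬e↦v = ⊥-elim (¬e↦v e↦v)
  pre-idem v (e ∷ es) | no ¬e↦v with tgt e ≟ v
  ...   | yes e↦v = ⊥-elim (¬e↦v e↦v)
  ...   | no _    = cong (e ∷_) (pre-idem v es)

  suf-pre : ∀ v xs → suf v (pre v xs) ≡ []
  suf-pre v [] = refl
  suf-pre v (e ∷ es) with tgt e ≟ v
  ... | yes e↦v with tgt e ≟ v
  ...   | yes _    = refl
  ...   | no ¬e↦v = ⊥-elim (¬e↦v e↦v)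
  suf-pre v (e ∷ es) | no ¬e↦v with tgt e ≟ v
  ...   | yes e↦v = ⊥-elim (¬e↦v e↦v)
  ...   | no _    = suf-pre v es

  pre-++ˡ : ∀ {v} xs ys → v ∈ᵥ xs → pre v (xs ++ ys) ≡ pre v xs
  pre-++ˡ {v} (e ∷ es) ys v∈ with tgt e ≟ v
  pre-++ˡ (e ∷ es) ys v∈         | yes _   = refl
  pre-++ˡ (e ∷ es) ys (here e↦v) | no ¬e↦v = ⊥-elim (¬e↦v e↦v)
  pre-++ˡ (e ∷ es) ys (there v∈) | no _    = cong (e ∷_) (pre-++ˡ es ys v∈)

  suf-++ˡ : ∀ {v} xs ys → v ∈ᵥ xs → suf v (xs ++ ys) ≡ suf v xs ++ ys
  suf-++ˡ {v} (e ∷ es) ys v∈ with tgt e ≟ v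
  suf-++ˡ (e ∷ es) ys v∈         | yes _   = refl
  suf-++ˡ (e ∷ es) ys (here e↦v) | no ¬e↦v = ⊥-elim (¬e↦v e↦v)
  suf-++ˡ (e ∷ es) ys (there v∈) | no _    = suf-++ˡ es ys v∈

  pre-++ʳ : ∀ {v} xs ys → ¬ v ∈ᵥ xs → pre v (xs ++ ys) ≡ xs ++ pre v ys
  pre-++ʳ [] ys v∉ = refl
  pre-++ʳ {v} (e ∷ es) ys v∉ with tgt e ≟ v
  ... | yes e↦v = ⊥-elim (v∉ (here e↦v))
  ... | no  _   = cong (e ∷_) (pre-++ʳ es ys (v∉ ∘ there))

  suf-++ʳ : ∀ {v} xs ys → ¬ v ∈ᵥ xs → suf v (xs ++ ys) ≡ suf v ys
  suf-++ʳ [] ys v∉ = refl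
  suf-++ʳ {v} (e ∷ es) ys v∉ with tgt e ≟ v
  ... | yes e↦v = ⊥-elim (v∉ (here e↦v))
  ... | no  _   = suf-++ʳ es ys (v∉ ∘ there)

  pre-splice : ∀ {v} P Q → v ∈ᵥ P → pre v (P ⟨ v ⟩ Q) ≡ pre v P
  pre-splice {v} P Q v∈ = trans (pre-++ˡ (pre v P) (suf v Q) (∈ᵥ-pre P v∈)) (pre-idem v P)

  suf-splice : ∀ {v} P Q → v ∈ᵥ P → suf v (P ⟨ v ⟩ Q) ≡ suf v Q
  suf-splice {v} P Q v∈ =
    trans (suf-++ˡ (pre v P) (suf v Q) (∈ᵥ-pre P v∈)) (cong (_++ suf v Q) (suf-pre v P))

  ∈ᵥ-splice : ∀ {v} P Q → v ∈ᵥ P → v ∈ᵥ P ⟨ v ⟩ Q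
  ∈ᵥ-splice P Q v∈ = Any.++⁺ˡ (∈ᵥ-pre P v∈)

  pre-before : ∀ {u v} Q → u ∈ᵥ pre v Q → pre u Q ≡ pre u (pre v Q)
  pre-before {u} {v} Q u∈ =
    trans (cong (pre u) (sym (pre++suf v Q))) (pre-++ˡ (pre v Q) (suf v Q) u∈)

  suf-before : ∀ {u v} Q → u ∈ᵥ pre v Q → suf u Q ≡ suf u (pre v Q) ++ suf v Q
  suf-before {u} {v} Q u∈ =
    trans (cong (suf u) (sym (pre++suf v Q))) (suf-++ˡ (pre v Q) (suf v Q) u∈)

  pre-after : ∀ {u v} Q → ¬ u ∈ᵥ pre v Q → pre u Q ≡ pre v Q ++ pre u (suf v Q)
  pre-after {u} {v} Q u∉ =
    trans (cong (pre u) (sym (pre++suf v Q))) (pre-++ʳ (pre v Q) (suf v Q) u∉)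

  suf-after : ∀ {u v} Q → ¬ u ∈ᵥ pre v Q → suf u Q ≡ suf u (suf v Q)
  suf-after {u} {v} Q u∉ =
    trans (cong (suf u) (sym (pre++suf v Q))) (suf-++ʳ (pre v Q) (suf v Q) u∉)

  path-≤ : ∀ {a xs b} → IsPath a xs b → a ≤ b
  path-≤ nil                   = Fin.≤-refl
  path-≤ (cons {e = e} refl p) = Fin.≤-trans (ℕ.<⇒≤ (increasing e)) (path-≤ p)

  source<∈ᵥ : ∀ {a xs b w} → IsPath a xs b → w ∈ᵥ xs → a < w
  source<∈ᵥ (cons {e = e} refl p) (here refl) = increasing e
  source<∈ᵥ (cons {e = e} refl p) (there w∈) = Fin.<-trans (increasing e) (source<∈ᵥ p w∈)

  ∈ᵥ≤target : ∀ {a xs b w} → IsPath a xs b → w ∈ᵥ xs → w ≤ b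
  ∈ᵥ≤target (cons refl p) (here refl) = path-≤ p
  ∈ᵥ≤target (cons refl p) (there w∈) = ∈ᵥ≤target p w∈

  path-loop : ∀ {a xs} → IsPath a xs a → xs ≡ []
  path-loop nil                   = refl
  path-loop (cons {e = e} refl p) = ⊥-elim (ℕ.<⇒≱ (increasing e) (path-≤ p))

  pre-target : ∀ {a xs b} → IsPath a xs b → pre b xs ≡ xs
  pre-target nil = refl
  pre-target {b = b} (cons {e = e} _ p) with tgt e ≟ b
  ... | yes refl = cong (e ∷_) (sym (path-loop p))
  ... | no  _    = cong (e ∷_) (pre-target p)

  suf-target : ∀ {a xs b} → IsPath a xs b → suf b xs ≡ []
  suf-target nil = refl
  suf-target {b = b} (cons {e = e} _ p) with tgt e ≟ b
  ... | yes refl = path-loop p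
  ... | no  _    = suf-target p

  target-∈ᵥ : ∀ {a xs b} → IsPath a xs b → a ≢ b → b ∈ᵥ xs
  target-∈ᵥ nil a≢b = ⊥-elim (a≢b refl)
  target-∈ᵥ {b = b} (cons {e = e} _ p) _ with tgt e ≟ b
  ... | yes e↦b = here e↦b
  ... | no ¬e↦b = there (target-∈ᵥ p ¬e↦b)

  pre-path : ∀ {a xs b v} → IsPath a xs b → v ∈ᵥ xs → IsPath a (pre v xs) v
  pre-path {v = v} (cons {e = e} _ p) v∈ with tgt e ≟ v
  pre-path (cons e↤a p) v∈         | yes refl = cons e↤a nil
  pre-path (cons e↤a p) (here e↦v) | no ¬e↦v  = ⊥-elim (¬e↦v e↦v)
  pre-path (cons e↤a p) (there v∈) | no _     = cons e↤a (pre-path p v∈)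

  suf-path : ∀ {a xs b v} → IsPath a xs b → v ∈ᵥ xs → IsPath v (suf v xs) b
  suf-path {v = v} (cons {e = e} _ p) v∈ with tgt e ≟ v
  suf-path (cons _ p) v∈         | yes refl = p
  suf-path (cons _ p) (here e↦v) | no ¬e↦v  = ⊥-elim (¬e↦v e↦v)
  suf-path (cons _ p) (there v∈) | no _     = suf-path p v∈

  path-++ : ∀ {a xs b ys c} → IsPath a xs b → IsPath b ys c → IsPath a (xs ++ ys) c
  path-++ nil          q = q
  path-++ (cons e↤a p) q = cons e↤a (path-++ p q)

  path-++⁻ : ∀ {a} xs {ys c} → IsPath a (xs ++ ys) c → ∃ λ b → IsPath a xs b × IsPath b ys c
  path-++⁻ []       p            = _ , nil , p
  path-++⁻ (x ∷ xs) (cons e↤a p) with path-++⁻ xs p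
  ... | b , p₁ , p₂ = b , cons e↤a p₁ , p₂

  same-source : ∀ {a b c d xs w} → IsPath a xs c → IsPath b xs d → w ∈ᵥ xs → a ≡ b
  same-source (cons e↤a _) (cons e↤b _) _ = trans (sym e↤a) e↤b

  ∈ᵥ⇒≢s : ∀ {v xs} → v ∈ᵥ xs → s ≢ v
  ∈ᵥ⇒≢s (here e↦v) refl = s-source _ e↦v
  ∈ᵥ⇒≢s (there v∈)      = ∈ᵥ⇒≢s v∈

  ∈ᵥ-pre⇒≤ : ∀ {a xs b u v} → IsPath a xs b → v ∈ᵥ xs → u ∈ᵥ pre v xs → u ≤ v
  ∈ᵥ-pre⇒≤ p v∈ = ∈ᵥ≤target (pre-path p v∈)

  ∈ᵥ-suf⇒> : ∀ {a xs b u v} → IsPath a xs b → v ∈ᵥ xs → u ∈ᵥ suf v xs → v < u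
  ∈ᵥ-suf⇒> p v∈ = source<∈ᵥ (suf-path p v∈)

  >⇒∉ᵥ-pre : ∀ {a xs b u v} → IsPath a xs b → v ∈ᵥ xs → v < u → ¬ u ∈ᵥ pre v xs
  >⇒∉ᵥ-pre p v∈ v<u u∈ = ℕ.<⇒≱ v<u (∈ᵥ-pre⇒≤ p v∈ u∈)

  <⇒∈ᵥ-pre : ∀ {a xs b u v} → IsPath a xs b → v ∈ᵥ xs → u ∈ᵥ xs → u < v → u ∈ᵥ pre v xs
  <⇒∈ᵥ-pre {xs = xs} {v = v} p v∈ u∈ u<v with ∈ᵥ-pre⊎suf v xs u∈
  ... | inj₁ u∈pre = u∈pre
  ... | inj₂ u∈suf = ⊥-elim (Fin.<-asym u<v (∈ᵥ-suf⇒> p v∈ u∈suf))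

  >⇒∈ᵥ-suf : ∀ {a xs b u v} → IsPath a xs b → v ∈ᵥ xs → u ∈ᵥ xs → v < u → u ∈ᵥ suf v xs
  >⇒∈ᵥ-suf {xs = xs} {v = v} p v∈ u∈ v<u with ∈ᵥ-pre⊎suf v xs u∈
  ... | inj₁ u∈pre = ⊥-elim (>⇒∉ᵥ-pre p v∈ v<u u∈pre)
  ... | inj₂ u∈suf = u∈suf

  splice-route : ∀ {v P Q} → IsRoute P → IsRoute Q → v ∈ᵥ P → v ∈ᵥ Q → IsRoute (P ⟨ v ⟩ Q)
  splice-route rP rQ v∈P v∈Q = path-++ (pre-path rP v∈P) (suf-path rQ v∈Q)

  suf-through : ∀ {Z u v seg r} → IsRoute Z → u ∈ᵥ Z → IsPath u seg v → u ≢ v →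
                suf u Z ≡ seg ++ r → pre v Z ≡ pre u Z ++ seg × suf v Z ≡ r × v ∈ᵥ Z
  suf-through {Z} {u} {v} {seg} {r} rZ u∈Z p u≢v eq = pre-eq , suf-eq , v∈Z
    where
      Z≡ : Z ≡ pre u Z ++ (seg ++ r)
      Z≡ = trans (sym (pre++suf u Z)) (cong (pre u Z ++_) eq)
      v∉ : ¬ v ∈ᵥ pre u Z
      v∉ v∈ = u≢v (Fin.≤-antisym (path-≤ p) (∈ᵥ≤target (pre-path rZ u∈Z) v∈))
      v∈seg : v ∈ᵥ seg
      v∈seg = target-∈ᵥ p u≢v
      pre-eq : pre v Z ≡ pre u Z ++ seg
      pre-eq = begin
        pre v Z                      ≡⟨ cong (pre v) Z≡ ⟩
        pre v (pre u Z ++ seg ++ r)  ≡⟨ pre-++ʳ (pre u Z) _ v∉ ⟩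
        pre u Z ++ pre v (seg ++ r)  ≡⟨ cong (pre u Z ++_) (pre-++ˡ seg r v∈seg) ⟩
        pre u Z ++ pre v seg         ≡⟨ cong (pre u Z ++_) (pre-target p) ⟩
        pre u Z ++ seg               ∎
        where open ≡-Reasoning
      suf-eq : suf v Z ≡ r
      suf-eq = begin
        suf v Z                      ≡⟨ cong (suf v) Z≡ ⟩
        suf v (pre u Z ++ seg ++ r)  ≡⟨ suf-++ʳ (pre u Z) _ v∉ ⟩
        suf v (seg ++ r)             ≡⟨ suf-++ˡ seg r v∈seg ⟩
        suf v seg ++ r               ≡⟨ cong (_++ r) (suf-target p) ⟩
        r                            ∎
        where open ≡-Reasoning
      v∈Z : v ∈ᵥ Z
      v∈Z = subst (v ∈ᵥ_) (sym Z≡) (Any.++⁺ʳ (pre u Z) (Any.++⁺ˡ v∈seg))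

  pre-through : ∀ {Z u v seg xs} → IsRoute Z → u ∈ᵥ Z → IsPath v seg u → v ≢ u → s ≢ v →
                pre u Z ≡ xs ++ seg → pre v Z ≡ xs × suf v Z ≡ seg ++ suf u Z × v ∈ᵥ Z
  pre-through {Z} {u} {v} {seg} {xs} rZ u∈Z p v≢u s≢v eq = pre-eq , suf-eq , v∈Z
    where
      xs-path : IsPath s xs v
      xs-path with path-++⁻ xs (subst (λ l → IsPath s l u) eq (pre-path rZ u∈Z))
      ... | b , p₁ , p₂ = subst (IsPath s xs) (same-source p₂ p (target-∈ᵥ p v≢u)) p₁
      v∈xs : v ∈ᵥ xs
      v∈xs = target-∈ᵥ xs-path s≢v
      Z≡ : Z ≡ xs ++ (seg ++ suf u Z)
      Z≡ = begin
        Z                        ≡⟨ sym (pre++suf u Z) ⟩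
        pre u Z ++ suf u Z       ≡⟨ cong (_++ suf u Z) eq ⟩
        (xs ++ seg) ++ suf u Z   ≡⟨ List.++-assoc xs seg (suf u Z) ⟩
        xs ++ (seg ++ suf u Z)   ∎
        where open ≡-Reasoning
      pre-eq : pre v Z ≡ xs
      pre-eq = trans (cong (pre v) Z≡) (trans (pre-++ˡ xs _ v∈xs) (pre-target xs-path))
      suf-eq : suf v Z ≡ seg ++ suf u Z
      suf-eq = trans (cong (suf v) Z≡)
                     (trans (suf-++ˡ xs _ v∈xs) (cong (_++ _) (suf-target xs-path)))
      v∈Z : v ∈ᵥ Z
      v∈Z = subst (v ∈ᵥ_) (sym Z≡) (Any.++⁺ˡ v∈xs)

  reverse-++-split : ∀ {xs} (seg r : List Edge) → reverse xs ≡ reverse seg ++ r → xs ≡ reverse r ++ seg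
  reverse-++-split {xs} seg r eq = begin
    xs                              ≡⟨ sym (List.reverse-involutive xs) ⟩
    reverse (reverse xs)            ≡⟨ cong reverse eq ⟩
    reverse (reverse seg ++ r)      ≡⟨ List.reverse-++ (reverse seg) r ⟩
    reverse r ++ reverse (reverse seg) ≡⟨ cong (reverse r ++_) (List.reverse-involutive seg) ⟩
    reverse r ++ seg                ∎
    where open ≡-Reasoning

  module _ (F : Defs.Framing G) where
    open Defs.Framing F

    _<ᵢ_ _<ₒ_ : Edge → Edge → Set
    _<ᵢ_ = Defs._<ᵢ_ G F
    _<ₒ_ = Defs._<ₒ_ G F

    BackLt FwdLt : List Edge → List Edge → Set
    BackLt = Defs.BackLt G F
    FwdLt  = Defs.FwdLt G F

    _<I[_]_ _<O[_]_ _≤I[_]_ CW : Route → Vertex → Route → Set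
    _<I[_]_     = Defs._<I[_]_ G F
    _<O[_]_     = Defs._<O[_]_ G F
    _≤I[_]_     = Defs._≤I[_]_ G F
    CW          = Defs.CW G F

    Incoherent : Route → Route → Vertex → Set
    Incoherent = Defs.Incoherent G F

    Coherent : Route → Route → Set
    Coherent = Defs.Coherent G F

    <ᵢ-trans : ∀ {a b c} → a <ᵢ b → b <ᵢ c → a <ᵢ c
    <ᵢ-trans (a≤b , _) (b≤c , b≢c) = ≤ᵢ-trans a≤b b≤c , λ { refl → b≢c (≤ᵢ-antisym b≤c a≤b) }

    <ₒ-trans : ∀ {a b c} → a <ₒ b → b <ₒ c → a <ₒ c
    <ₒ-trans (a≤b , _) (b≤c , b≢c) = ≤ₒ-trans a≤b b≤c , λ { refl → b≢c (≤ₒ-antisym b≤c a≤b) }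

    BackLt-irrefl : ∀ {xs} → ¬ BackLt xs xs
    BackLt-irrefl (here (_ , a≢a)) = a≢a refl
    BackLt-irrefl (there lt)       = BackLt-irrefl lt

    FwdLt-irrefl : ∀ {xs} → ¬ FwdLt xs xs
    FwdLt-irrefl (here (_ , a≢a)) = a≢a refl
    FwdLt-irrefl (there lt)       = FwdLt-irrefl lt

    BackLt-trans : ∀ {xs ys zs} → BackLt xs ys → BackLt ys zs → BackLt xs zs
    BackLt-trans (here a<b)  (here b<c)  = here (<ᵢ-trans a<b b<c)
    BackLt-trans (here a<b)  (there _)   = here a<b
    BackLt-trans (there _)   (here b<c)  = here b<c
    BackLt-trans (there lt₁) (there lt₂) = there (BackLt-trans lt₁ lt₂)

    FwdLt-trans : ∀ {xs ys zs} → FwdLt xs ys → FwdLt ys zs → FwdLt xs zs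
    FwdLt-trans (here a<b)  (here b<c)  = here (<ₒ-trans a<b b<c)
    FwdLt-trans (here a<b)  (there _)   = here a<b
    FwdLt-trans (there _)   (here b<c)  = here b<c
    FwdLt-trans (there lt₁) (there lt₂) = there (FwdLt-trans lt₁ lt₂)

    BackLt-++⁺ : ∀ seg {xs ys} → BackLt xs ys → BackLt (seg ++ xs) (seg ++ ys)
    BackLt-++⁺ []        lt = lt
    BackLt-++⁺ (_ ∷ seg) lt = there (BackLt-++⁺ seg lt)

    FwdLt-++⁺ : ∀ seg {xs ys} → FwdLt xs ys → FwdLt (seg ++ xs) (seg ++ ys)
    FwdLt-++⁺ []        lt = lt
    FwdLt-++⁺ (_ ∷ seg) lt = there (FwdLt-++⁺ seg lt)

    BackLt-++-casesˡ : ∀ seg {xs ys zs} → BackLt (seg ++ xs) zs →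
                       BackLt (seg ++ ys) zs ⊎ ∃ λ r → zs ≡ seg ++ r × BackLt xs r
    BackLt-++-casesˡ []        lt         = inj₂ (_ , refl , lt)
    BackLt-++-casesˡ (_ ∷ seg) (here a<b) = inj₁ (here a<b)
    BackLt-++-casesˡ (_ ∷ seg) (there lt) with BackLt-++-casesˡ seg lt
    ... | inj₁ lt′              = inj₁ (there lt′)
    ... | inj₂ (r , refl , lt′) = inj₂ (r , refl , lt′)

    BackLt-++-casesʳ : ∀ seg {xs ys zs} → BackLt zs (seg ++ xs) →
                       BackLt zs (seg ++ ys) ⊎ ∃ λ r → zs ≡ seg ++ r × BackLt r xs
    BackLt-++-casesʳ []        lt         = inj₂ (_ , refl , lt)
    BackLt-++-casesʳ (_ ∷ seg) (here a<b) = inj₁ (here a<b)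
    BackLt-++-casesʳ (_ ∷ seg) (there lt) with BackLt-++-casesʳ seg lt
    ... | inj₁ lt′              = inj₁ (there lt′)
    ... | inj₂ (r , refl , lt′) = inj₂ (r , refl , lt′)

    FwdLt-++-casesˡ : ∀ seg {xs ys zs} → FwdLt (seg ++ xs) zs →
                      FwdLt (seg ++ ys) zs ⊎ ∃ λ r → zs ≡ seg ++ r × FwdLt xs r
    FwdLt-++-casesˡ []        lt         = inj₂ (_ , refl , lt)
    FwdLt-++-casesˡ (_ ∷ seg) (here a<b) = inj₁ (here a<b)
    FwdLt-++-casesˡ (_ ∷ seg) (there lt) with FwdLt-++-casesˡ seg lt
    ... | inj₁ lt′              = inj₁ (there lt′)
    ... | inj₂ (r , refl , lt′) = inj₂ (r , refl , lt′)

    FwdLt-++-casesʳ : ∀ seg {xs ys zs} → FwdLt zs (seg ++ xs) →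
                      FwdLt zs (seg ++ ys) ⊎ ∃ λ r → zs ≡ seg ++ r × FwdLt r xs
    FwdLt-++-casesʳ []        lt         = inj₂ (_ , refl , lt)
    FwdLt-++-casesʳ (_ ∷ seg) (here a<b) = inj₁ (here a<b)
    FwdLt-++-casesʳ (_ ∷ seg) (there lt) with FwdLt-++-casesʳ seg lt
    ... | inj₁ lt′              = inj₁ (there lt′)
    ... | inj₂ (r , refl , lt′) = inj₂ (r , refl , lt′)

    FwdLt-trichotomy : ∀ {a xs ys} → IsPath a xs t → IsPath a ys t →
                       FwdLt xs ys ⊎ xs ≡ ys ⊎ FwdLt ys xs
    FwdLt-trichotomy nil nil                    = inj₂ (inj₁ refl)
    FwdLt-trichotomy nil (cons {e = e} e↤t _)   = ⊥-elim (t-sink e e↤t)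
    FwdLt-trichotomy (cons {e = e} e↤t _) nil   = ⊥-elim (t-sink e e↤t)
    FwdLt-trichotomy (cons {e = e} e↤a p) (cons {e = f} f↤a q) with e ≟ f
    ... | yes refl = Sum.map there (Sum.map (cong (e ∷_)) there) (FwdLt-trichotomy p q)
    ... | no e≢f with ≤ₒ-total e f (trans e↤a (sym f↤a))
    ...   | inj₁ e≤f = inj₁ (here (e≤f , e≢f))
    ...   | inj₂ f≤e = inj₂ (inj₂ (here (f≤e , e≢f ∘ sym)))

    -- RevPath b rs a: rs lists the edges of a path from a to b starting at b, the form in which Pv is compared.
    data RevPath : Vertex → List Edge → Vertex → Set where
      nil  : ∀ {a} → RevPath a [] a
      cons : ∀ {b e rs a} → tgt e ≡ b → RevPath (src e) rs a → RevPath b (e ∷ rs) a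

    RevPath-∷ʳ : ∀ {b rs c e a} → RevPath b rs c → tgt e ≡ c → src e ≡ a → RevPath b (rs ++ e ∷ []) a
    RevPath-∷ʳ nil          refl refl = cons refl nil
    RevPath-∷ʳ (cons e↦b p) e↦c  e↤a  = cons e↦b (RevPath-∷ʳ p e↦c e↤a)

    reverse-path : ∀ {a xs b} → IsPath a xs b → RevPath b (reverse xs) a
    reverse-path nil = nil
    reverse-path {a} {b = b} (cons {e = e} {es = es} e↤a p) =
      subst (λ l → RevPath b l a) (sym (List.unfold-reverse e es)) (RevPath-∷ʳ (reverse-path p) refl e↤a)

    BackLt-trichotomy : ∀ {b xs ys} → RevPath b xs s → RevPath b ys s →
                        BackLt xs ys ⊎ xs ≡ ys ⊎ BackLt ys xs
    BackLt-trichotomy nil nil                    = inj₂ (inj₁ refl)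
    BackLt-trichotomy nil (cons {e = e} e↦s _)   = ⊥-elim (s-source e e↦s)
    BackLt-trichotomy (cons {e = e} e↦s _) nil   = ⊥-elim (s-source e e↦s)
    BackLt-trichotomy (cons {e = e} e↦b p) (cons {e = f} f↦b q) with e ≟ f
    ... | yes refl = Sum.map there (Sum.map (cong (e ∷_)) there) (BackLt-trichotomy p q)
    ... | no e≢f with ≤ᵢ-total e f (trans e↦b (sym f↦b))
    ...   | inj₁ e≤f = inj₁ (here (e≤f , e≢f))
    ...   | inj₂ f≤e = inj₂ (inj₂ (here (f≤e , e≢f ∘ sym)))

    compareᴵ : ∀ {P Q v} → IsRoute P → IsRoute Q → v ∈ᵥ P → v ∈ᵥ Q →
               P <I[ v ] Q ⊎ pre v P ≡ pre v Q ⊎ Q <I[ v ] P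
    compareᴵ rP rQ v∈P v∈Q =
      Sum.map₂ (Sum.map₁ List.reverse-injective)
        (BackLt-trichotomy (reverse-path (pre-path rP v∈P)) (reverse-path (pre-path rQ v∈Q)))

    compareᴼ : ∀ {P Q v} → IsRoute P → IsRoute Q → v ∈ᵥ P → v ∈ᵥ Q →
               P <O[ v ] Q ⊎ suf v P ≡ suf v Q ⊎ Q <O[ v ] P
    compareᴼ rP rQ v∈P v∈Q = FwdLt-trichotomy (suf-path rP v∈P) (suf-path rQ v∈Q)

    <I-respˡ : ∀ {xs xs′ ys} → xs ≡ xs′ → BackLt (reverse xs) ys → BackLt (reverse xs′) ys
    <I-respˡ refl lt = lt

    <I-respʳ : ∀ {xs ys ys′} → ys ≡ ys′ → BackLt xs (reverse ys) → BackLt xs (reverse ys′)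
    <I-respʳ refl lt = lt

    <O-respˡ : ∀ {xs xs′ ys} → xs ≡ xs′ → FwdLt xs ys → FwdLt xs′ ys
    <O-respˡ refl lt = lt

    <O-respʳ : ∀ {xs ys ys′} → ys ≡ ys′ → FwdLt xs ys → FwdLt xs ys′
    <O-respʳ refl lt = lt

    <I-extend : ∀ {u v} X Y seg → pre v X ≡ pre u X ++ seg → pre v Y ≡ pre u Y ++ seg →
                X <I[ u ] Y → X <I[ v ] Y
    <I-extend X Y seg eqX eqY lt =
      subst₂ BackLt (sym (reverse-++ eqX)) (sym (reverse-++ eqY)) (BackLt-++⁺ (reverse seg) lt)
      where
        reverse-++ : ∀ {xs ys} → xs ≡ ys ++ seg → reverse xs ≡ reverse seg ++ reverse ys
        reverse-++ {ys = ys} eq = trans (cong reverse eq) (List.reverse-++ ys seg)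

    incoherent⇒inner : ∀ {P Q v} → Incoherent P Q v → Inner v P × Inner v Q
    incoherent⇒inner (inj₁ (iP , iQ , _)) = iP , iQ
    incoherent⇒inner (inj₂ (iQ , iP , _)) = iP , iQ

    coherent-sym : ∀ {P Q} → Coherent P Q → Coherent Q P
    coherent-sym coh v = coh v ∘ Sum.swap

    coherent-refl : ∀ {P} → Coherent P P
    coherent-refl v (inj₁ (_ , _ , lt , _)) = BackLt-irrefl lt
    coherent-refl v (inj₂ (_ , _ , lt , _)) = BackLt-irrefl lt

    incoherent⇒pre≢ : ∀ {P Q v} → Incoherent P Q v → pre v P ≢ pre v Q
    incoherent⇒pre≢ (inj₁ (_ , _ , lt , _)) eq = BackLt-irrefl (<I-respˡ eq lt)
    incoherent⇒pre≢ (inj₂ (_ , _ , lt , _)) eq = BackLt-irrefl (<I-respʳ eq lt)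

    incoherent⇒suf≢ : ∀ {P Q v} → Incoherent P Q v → suf v P ≢ suf v Q
    incoherent⇒suf≢ (inj₁ (_ , _ , _ , lt)) eq = FwdLt-irrefl (<O-respʳ eq lt)
    incoherent⇒suf≢ (inj₂ (_ , _ , _ , lt)) eq = FwdLt-irrefl (<O-respˡ eq lt)

    -- P′ agrees with P up to v, and u precedes v on P. Writing uP = seg ++ vP, the comparison of uZ
    -- with uP is decided either inside seg, and then equally with uP′, or after it, and then Z runs
    -- along seg to v, where the incoherence reappears.
    module Before {P P′ Z u v} (rP : IsRoute P) (rZ : IsRoute Z) (agree : pre v P ≡ pre v P′)
                  (u∈ : u ∈ᵥ pre v P) (u≢v : u ≢ v) (iP : Inner v P) where

      seg : List Edge
      seg = suf u (pre v P)

      u∈′ : u ∈ᵥ pre v P′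
      u∈′ = subst (u ∈ᵥ_) agree u∈

      pre-agree : pre u P ≡ pre u P′
      pre-agree = trans (pre-before P u∈) (trans (cong (pre u) agree) (sym (pre-before P′ u∈′)))

      suf-P : suf u P ≡ seg ++ suf v P
      suf-P = suf-before P u∈

      suf-P′ : suf u P′ ≡ seg ++ suf v P′
      suf-P′ = trans (suf-before P′ u∈′) (cong (λ l → suf u l ++ suf v P′) (sym agree))

      pre-P : pre v P ≡ pre u P ++ seg
      pre-P = trans (sym (pre++suf u (pre v P))) (cong (_++ seg) (sym (pre-before P u∈)))

      inner-P′ : u ≢ t → Inner u P′
      inner-P′ u≢t = ∈ᵥ-pre⇒∈ᵥ v P′ u∈′ , u≢t

      follows : ∀ {r} → u ∈ᵥ Z → suf u Z ≡ seg ++ r →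
                Inner v Z × pre v Z ≡ pre u Z ++ seg × suf v Z ≡ r × P ⟨ u ⟩ Z ≡ P ⟨ v ⟩ Z
      follows {r} u∈Z eq with suf-through rZ u∈Z (suf-path (pre-path rP (proj₁ iP)) u∈) u≢v eq
      ... | pre-Z , suf-Z , v∈Z = (v∈Z , proj₂ iP) , pre-Z , suf-Z , splice-eq
        where
          open ≡-Reasoning
          splice-eq : P ⟨ u ⟩ Z ≡ P ⟨ v ⟩ Z
          splice-eq = begin
            pre u P ++ suf u Z      ≡⟨ cong (pre u P ++_) eq ⟩
            pre u P ++ (seg ++ r)   ≡⟨ List.++-assoc (pre u P) seg r ⟨
            (pre u P ++ seg) ++ r   ≡⟨ cong₂ _++_ pre-P suf-Z ⟨
            pre v P ++ suf v Z      ∎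

      transferˡ : CW Z u P → CW Z u P′ ⊎ (CW Z v P × P ⟨ u ⟩ Z ≡ P ⟨ v ⟩ Z)
      transferˡ (iZ , iuP , lt-in , lt-out) with FwdLt-++-casesˡ seg (<O-respˡ suf-P lt-out)
      ... | inj₁ lt = inj₁ (iZ , inner-P′ (proj₂ iuP) , <I-respʳ pre-agree lt-in , <O-respˡ (sym suf-P′) lt)
      ... | inj₂ (r , eq , lt) with follows (proj₁ iZ) eq
      ...   | ivZ , pre-Z , suf-Z , splice-eq =
              inj₂ ((ivZ , iP , <I-extend Z P seg pre-Z pre-P lt-in , <O-respʳ (sym suf-Z) lt) , splice-eq)

      transferʳ : CW P u Z → CW P′ u Z ⊎ (CW P v Z × P ⟨ u ⟩ Z ≡ P ⟨ v ⟩ Z)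
      transferʳ (iuP , iZ , lt-in , lt-out) with FwdLt-++-casesʳ seg (<O-respʳ suf-P lt-out)
      ... | inj₁ lt = inj₁ (inner-P′ (proj₂ iuP) , iZ , <I-respˡ pre-agree lt-in , <O-respʳ (sym suf-P′) lt)
      ... | inj₂ (r , eq , lt) with follows (proj₁ iZ) eq
      ...   | ivZ , pre-Z , suf-Z , splice-eq =
              inj₂ ((iP , ivZ , <I-extend P Z seg pre-P pre-Z lt-in , <O-respˡ (sym suf-Z) lt) , splice-eq)

    incoherent-before : ∀ {P P′ Z u v} → IsRoute P → IsRoute Z → pre v P ≡ pre v P′ →
                        u ∈ᵥ pre v P → u ≢ v → Inner v P → Incoherent Z P u →
                        Incoherent Z P′ u ⊎ (Incoherent Z P v × P ⟨ u ⟩ Z ≡ P ⟨ v ⟩ Z)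
    incoherent-before rP rZ agree u∈ u≢v iP (inj₁ cw) =
      Sum.map inj₁ (Product.map₁ inj₁) (Before.transferˡ rP rZ agree u∈ u≢v iP cw)
    incoherent-before rP rZ agree u∈ u≢v iP (inj₂ cw) =
      Sum.map inj₂ (Product.map₁ inj₂) (Before.transferʳ rP rZ agree u∈ u≢v iP cw)

    module After {P P′ Z u v} (rP : IsRoute P) (rP′ : IsRoute P′) (rZ : IsRoute Z)
                 (agree : suf v P ≡ suf v P′) (v∈P′ : v ∈ᵥ P′) (u∈ : u ∈ᵥ suf v P) (iP : Inner v P) where

      seg : List Edge
      seg = pre u (suf v P)

      v<u : v < u
      v<u = ∈ᵥ-suf⇒> rP (proj₁ iP) u∈

      u∉P : ¬ u ∈ᵥ pre v P
      u∉P = >⇒∉ᵥ-pre rP (proj₁ iP) v<u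

      u∉P′ : ¬ u ∈ᵥ pre v P′
      u∉P′ = >⇒∉ᵥ-pre rP′ v∈P′ v<u

      rev-pre-P : reverse (pre u P) ≡ reverse seg ++ reverse (pre v P)
      rev-pre-P = trans (cong reverse (pre-after P u∉P)) (List.reverse-++ (pre v P) seg)

      rev-pre-P′ : reverse (pre u P′) ≡ reverse seg ++ reverse (pre v P′)
      rev-pre-P′ = trans (cong reverse (pre-after P′ u∉P′))
                   (trans (List.reverse-++ (pre v P′) _)
                          (cong (λ l → reverse (pre u l) ++ _) (sym agree)))

      suf-agree : suf u P ≡ suf u P′
      suf-agree = trans (suf-after P u∉P) (trans (cong (suf u) agree) (sym (suf-after P′ u∉P′)))

      suf-P : suf v P ≡ seg ++ suf u P
      suf-P = trans (sym (pre++suf u (suf v P))) (cong (seg ++_) (sym (suf-after P u∉P)))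

      inner-P′ : u ≢ t → Inner u P′
      inner-P′ u≢t = ∈ᵥ-suf⇒∈ᵥ v P′ (subst (u ∈ᵥ_) agree u∈) , u≢t

      follows : ∀ {r} → u ∈ᵥ Z → reverse (pre u Z) ≡ reverse seg ++ r →
                Inner v Z × reverse (pre v Z) ≡ r × suf v Z ≡ seg ++ suf u Z × Z ⟨ v ⟩ P ≡ Z ⟨ u ⟩ P
      follows {r} u∈Z eq with pre-through {xs = reverse r} rZ u∈Z (pre-path (suf-path rP (proj₁ iP)) u∈)
                                         (Fin.<⇒≢ v<u) (∈ᵥ⇒≢s (proj₁ iP)) (reverse-++-split seg r eq)
      ... | pre-Z , suf-Z , v∈Z =
            (v∈Z , proj₂ iP) , trans (cong reverse pre-Z) (List.reverse-involutive r) , suf-Z , splice-eq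
        where
          open ≡-Reasoning
          splice-eq : Z ⟨ v ⟩ P ≡ Z ⟨ u ⟩ P
          splice-eq = begin
            pre v Z ++ suf v P              ≡⟨ cong₂ _++_ pre-Z suf-P ⟩
            reverse r ++ (seg ++ suf u P)   ≡⟨ List.++-assoc (reverse r) seg (suf u P) ⟨
            (reverse r ++ seg) ++ suf u P   ≡⟨ cong (_++ suf u P) (reverse-++-split seg r eq) ⟨
            pre u Z ++ suf u P              ∎

      transferˡ : CW Z u P → CW Z u P′ ⊎ (CW Z v P × Z ⟨ v ⟩ P ≡ Z ⟨ u ⟩ P)
      transferˡ (iZ , iuP , lt-in , lt-out)
        with BackLt-++-casesʳ (reverse seg) (subst (BackLt _) rev-pre-P lt-in)
      ... | inj₁ lt =
            inj₁ (iZ , inner-P′ (proj₂ iuP) , subst (BackLt _) (sym rev-pre-P′) lt , <O-respˡ suf-agree lt-out)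
      ... | inj₂ (r , eq , lt) with follows (proj₁ iZ) eq
      ...   | ivZ , rev-pre-Z , suf-Z , splice-eq =
              inj₂ ((ivZ , iP , subst (λ l → BackLt l _) (sym rev-pre-Z) lt ,
                     <O-respˡ (sym suf-P) (<O-respʳ (sym suf-Z) (FwdLt-++⁺ seg lt-out))) , splice-eq)

      transferʳ : CW P u Z → CW P′ u Z ⊎ (CW P v Z × Z ⟨ v ⟩ P ≡ Z ⟨ u ⟩ P)
      transferʳ (iuP , iZ , lt-in , lt-out)
        with BackLt-++-casesˡ (reverse seg) (subst (λ l → BackLt l _) rev-pre-P lt-in)
      ... | inj₁ lt =
            inj₁ (inner-P′ (proj₂ iuP) , iZ , subst (λ l → BackLt l _) (sym rev-pre-P′) lt ,
                  <O-respʳ suf-agree lt-out)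
      ... | inj₂ (r , eq , lt) with follows (proj₁ iZ) eq
      ...   | ivZ , rev-pre-Z , suf-Z , splice-eq =
              inj₂ ((iP , ivZ , subst (BackLt _) (sym rev-pre-Z) lt ,
                     <O-respʳ (sym suf-P) (<O-respˡ (sym suf-Z) (FwdLt-++⁺ seg lt-out))) , splice-eq)

    incoherent-after : ∀ {P P′ Z u v} → IsRoute P → IsRoute P′ → IsRoute Z → suf v P ≡ suf v P′ →
                       v ∈ᵥ P′ → u ∈ᵥ suf v P → Inner v P → Incoherent Z P u →
                       Incoherent Z P′ u ⊎ (Incoherent Z P v × Z ⟨ v ⟩ P ≡ Z ⟨ u ⟩ P)
    incoherent-after rP rP′ rZ agree v∈P′ u∈ iP (inj₁ cw) =
      Sum.map inj₁ (Product.map₁ inj₁) (After.transferˡ rP rP′ rZ agree v∈P′ u∈ iP cw)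
    incoherent-after rP rP′ rZ agree v∈P′ u∈ iP (inj₂ cw) =
      Sum.map inj₂ (Product.map₁ inj₂) (After.transferʳ rP rP′ rZ agree v∈P′ u∈ iP cw)

    incoherent-at-junction : ∀ {A P Q Z u v} → IsRoute A → IsRoute Q → IsRoute Z → Inner v A →
                             pre v A ≡ pre v P → suf v A ≡ suf v Q → v ∈ᵥ Q →
                             Coherent Z P → Coherent Z Q → Incoherent Z A u → Incoherent Z A v
    incoherent-at-junction {A} {u = u} {v} rA rQ rZ iA agreeP agreeQ v∈Q cohP cohQ inc =
      junction (∈ᵥ-pre⊎suf v A (proj₁ (proj₂ (incoherent⇒inner inc))))
      where
        junction : u ∈ᵥ pre v A ⊎ u ∈ᵥ suf v A → Incoherent _ A v
        junction (inj₁ u∈pre) with u ≟ v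
        ... | yes refl = inc
        ... | no u≢v   = [ ⊥-elim ∘ cohP u , proj₁ ]′ (incoherent-before rA rZ agreeP u∈pre u≢v iA inc)
        junction (inj₂ u∈suf) =
          [ ⊥-elim ∘ cohQ u , proj₁ ]′ (incoherent-after rA rQ rZ agreeQ v∈Q u∈suf iA inc)

    incoherent-splice : ∀ {P Q Z v} → Incoherent P Q v → Incoherent Z (P ⟨ v ⟩ Q) v →
                        Incoherent Z P v ⊎ Incoherent Z Q v
    incoherent-splice {P} {Q} {v = v} incPQ = go incPQ
      where
        v∈P : v ∈ᵥ P
        v∈P = proj₁ (proj₁ (incoherent⇒inner incPQ))
        pre-A : pre v (P ⟨ v ⟩ Q) ≡ pre v P
        pre-A = pre-splice P Q v∈P
        suf-A : suf v (P ⟨ v ⟩ Q) ≡ suf v Q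
        suf-A = suf-splice P Q v∈P
        go : Incoherent P Q v → Incoherent _ (P ⟨ v ⟩ Q) v → Incoherent _ P v ⊎ Incoherent _ Q v
        go (inj₁ (iP , iQ , P<ᴵQ , Q<ᴼP)) (inj₁ (iZ , _ , Z<ᴵA , A<ᴼZ)) =
          inj₂ (inj₁ (iZ , iQ , BackLt-trans (<I-respʳ pre-A Z<ᴵA) P<ᴵQ , <O-respˡ suf-A A<ᴼZ))
        go (inj₂ (iQ , iP , Q<ᴵP , P<ᴼQ)) (inj₁ (iZ , _ , Z<ᴵA , A<ᴼZ)) =
          inj₁ (inj₁ (iZ , iP , <I-respʳ pre-A Z<ᴵA , FwdLt-trans P<ᴼQ (<O-respˡ suf-A A<ᴼZ)))
        go (inj₁ (iP , iQ , P<ᴵQ , Q<ᴼP)) (inj₂ (_ , iZ , A<ᴵZ , Z<ᴼA)) =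
          inj₁ (inj₂ (iP , iZ , <I-respˡ pre-A A<ᴵZ , FwdLt-trans (<O-respʳ suf-A Z<ᴼA) Q<ᴼP))
        go (inj₂ (iQ , iP , Q<ᴵP , P<ᴼQ)) (inj₂ (_ , iZ , A<ᴵZ , Z<ᴼA)) =
          inj₂ (inj₂ (iQ , iZ , BackLt-trans Q<ᴵP (<I-respˡ pre-A A<ᴵZ) , <O-respʳ suf-A Z<ᴼA))

    coherent-splice : ∀ {P Q Z v} → IsRoute P → IsRoute Q → IsRoute Z → Incoherent P Q v →
                      Coherent Z P → Coherent Z Q → Coherent Z (P ⟨ v ⟩ Q)
    coherent-splice {P} {Q} {v = v} rP rQ rZ incPQ cohP cohQ u inc =
      [ cohP v , cohQ v ]′ (incoherent-splice incPQ
        (incoherent-at-junction (splice-route rP rQ v∈P v∈Q) rQ rZ (∈ᵥ-splice P Q v∈P , v≢t)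
           (pre-splice P Q v∈P) (suf-splice P Q v∈P) v∈Q cohP cohQ inc))
      where
        v∈P : v ∈ᵥ P
        v∈P = proj₁ (proj₁ (incoherent⇒inner incPQ))
        v≢t : v ≢ t
        v≢t = proj₂ (proj₁ (incoherent⇒inner incPQ))
        v∈Q : v ∈ᵥ Q
        v∈Q = proj₁ (proj₂ (incoherent⇒inner incPQ))

    splice₁₂-incoherent : ∀ {R₁ R₂ x y} → IsRoute R₁ → IsRoute R₂ → Incoherent R₁ R₂ x →
                         Incoherent (R₁ ⟨ x ⟩ R₂) R₁ y → y ∈ᵥ suf x R₂ × Incoherent R₁ R₂ y
    splice₁₂-incoherent {R₁} {R₂} {x} {y} r₁ r₂ inc₁₂ inc =
      go (∈ᵥ-pre⊎suf x A (proj₁ (proj₁ (incoherent⇒inner inc))))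
      where
        A : Route
        A = R₁ ⟨ x ⟩ R₂
        x∈R₁ : x ∈ᵥ R₁
        x∈R₁ = proj₁ (proj₁ (incoherent⇒inner inc₁₂))
        x∈R₂ : x ∈ᵥ R₂
        x∈R₂ = proj₁ (proj₂ (incoherent⇒inner inc₁₂))
        iA : Inner x A
        iA = ∈ᵥ-splice R₁ R₂ x∈R₁ , proj₂ (proj₁ (incoherent⇒inner inc₁₂))
        go : y ∈ᵥ pre x A ⊎ y ∈ᵥ suf x A → y ∈ᵥ suf x R₂ × Incoherent R₁ R₂ y
        go (inj₁ y∈pre) = ⊥-elim (incoherent⇒pre≢ inc same-pre)
          where
            same-pre : pre y A ≡ pre y R₁
            same-pre = trans (pre-before A y∈pre)
                       (trans (cong (pre y) (pre-splice R₁ R₂ x∈R₁))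
                              (sym (pre-before R₁ (subst (y ∈ᵥ_) (pre-splice R₁ R₂ x∈R₁) y∈pre))))
        go (inj₂ y∈suf) with incoherent-after (splice-route r₁ r₂ x∈R₁ x∈R₂) r₂ r₁
                               (suf-splice R₁ R₂ x∈R₁) x∈R₂ y∈suf iA (Sum.swap inc)
        ... | inj₁ inc-y        = subst (y ∈ᵥ_) (suf-splice R₁ R₂ x∈R₁) y∈suf , inc-y
        ... | inj₂ (inc-x , _) = ⊥-elim (incoherent⇒pre≢ inc-x (sym (pre-splice R₁ R₂ x∈R₁)))

    splice₁₂-stable : ∀ {R₁ R₂ x y} → IsRoute R₁ → IsRoute R₂ → Incoherent R₁ R₂ x → y ∈ᵥ suf x R₂ →
                     Incoherent R₁ R₂ y → Coherent R₂ (R₁ ⟨ y ⟩ R₂) → R₁ ⟨ x ⟩ R₂ ≡ R₁ ⟨ y ⟩ R₂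
    splice₁₂-stable {R₁} {R₂} {x} {y} r₁ r₂ inc-x y∈ inc-y coh =
      [ ⊥-elim ∘ coh x , proj₂ ]′
        (incoherent-before r₁ r₂ (sym (pre-splice R₁ R₂ y∈R₁)) x∈pre (Fin.<⇒≢ x<y) iyR₁ (Sum.swap inc-x))
      where
        iyR₁ : Inner y R₁
        iyR₁ = proj₁ (incoherent⇒inner inc-y)
        y∈R₁ : y ∈ᵥ R₁
        y∈R₁ = proj₁ iyR₁
        x∈R₁ : x ∈ᵥ R₁
        x∈R₁ = proj₁ (proj₁ (incoherent⇒inner inc-x))
        x<y : x < y
        x<y = ∈ᵥ-suf⇒> r₂ (proj₁ (proj₂ (incoherent⇒inner inc-x))) y∈
        x∈pre : x ∈ᵥ pre y R₁
        x∈pre = <⇒∈ᵥ-pre r₁ y∈R₁ x∈R₁ x<y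

    splice₂₁-incoherent : ∀ {R₁ R₂ x y} → IsRoute R₁ → IsRoute R₂ → Incoherent R₁ R₂ x →
                         Incoherent (R₂ ⟨ x ⟩ R₁) R₁ y → y ∈ᵥ pre x R₂ × y ≢ x × Incoherent R₁ R₂ y
    splice₂₁-incoherent {R₁} {R₂} {x} {y} r₁ r₂ inc₁₂ inc =
      go (∈ᵥ-pre⊎suf x B (proj₁ (proj₁ (incoherent⇒inner inc))))
      where
        B : Route
        B = R₂ ⟨ x ⟩ R₁
        x∈R₁ : x ∈ᵥ R₁
        x∈R₁ = proj₁ (proj₁ (incoherent⇒inner inc₁₂))
        x∈R₂ : x ∈ᵥ R₂
        x∈R₂ = proj₁ (proj₂ (incoherent⇒inner inc₁₂))
        x∈B : x ∈ᵥ B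
        x∈B = ∈ᵥ-splice R₂ R₁ x∈R₂
        rB : IsRoute B
        rB = splice-route r₂ r₁ x∈R₂ x∈R₁
        go : y ∈ᵥ pre x B ⊎ y ∈ᵥ suf x B → y ∈ᵥ pre x R₂ × y ≢ x × Incoherent R₁ R₂ y
        go (inj₂ y∈suf) = ⊥-elim (incoherent⇒suf≢ inc same-suf)
          where
            x<y : x < y
            x<y = ∈ᵥ-suf⇒> rB x∈B y∈suf
            same-suf : suf y B ≡ suf y R₁
            same-suf = trans (suf-after B (>⇒∉ᵥ-pre rB x∈B x<y))
                       (trans (cong (suf y) (suf-splice R₂ R₁ x∈R₂))
                              (sym (suf-after R₁ (>⇒∉ᵥ-pre r₁ x∈R₁ x<y))))
        go (inj₁ y∈pre) with y ≟ x
        ... | yes refl = ⊥-elim (incoherent⇒suf≢ inc (suf-splice R₂ R₁ x∈R₂))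
        ... | no y≢x with incoherent-before rB r₁ (pre-splice R₂ R₁ x∈R₂) y∈pre y≢x
                            (x∈B , proj₂ (proj₁ (incoherent⇒inner inc₁₂))) (Sum.swap inc)
        ...   | inj₁ inc-y        = subst (y ∈ᵥ_) (pre-splice R₂ R₁ x∈R₂) y∈pre , y≢x , inc-y
        ...   | inj₂ (inc-x , _) = ⊥-elim (incoherent⇒suf≢ inc-x (sym (suf-splice R₂ R₁ x∈R₂)))

    splice₂₁-stable : ∀ {R₁ R₂ x y} → IsRoute R₁ → IsRoute R₂ → Incoherent R₁ R₂ x → y ∈ᵥ pre x R₂ →
                     y ≢ x → Incoherent R₁ R₂ y → Coherent R₂ (R₂ ⟨ y ⟩ R₁) → R₂ ⟨ x ⟩ R₁ ≡ R₂ ⟨ y ⟩ R₁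
    splice₂₁-stable {R₁} {R₂} {x} {y} r₁ r₂ inc-x y∈ y≢x inc-y coh =
      [ ⊥-elim ∘ coh x , sym ∘ proj₂ ]′
        (incoherent-after r₁ (splice-route r₂ r₁ y∈R₂ y∈R₁) r₂ (sym (suf-splice R₂ R₁ y∈R₂))
           (∈ᵥ-splice R₂ R₁ y∈R₂) x∈suf iyR₁ (Sum.swap inc-x))
      where
        iyR₁ : Inner y R₁
        iyR₁ = proj₁ (incoherent⇒inner inc-y)
        y∈R₁ : y ∈ᵥ R₁
        y∈R₁ = proj₁ iyR₁
        y∈R₂ : y ∈ᵥ R₂
        y∈R₂ = proj₁ (proj₂ (incoherent⇒inner inc-y))
        y<x : y < x
        y<x = Fin.≤∧≢⇒< (∈ᵥ-pre⇒≤ r₂ (proj₁ (proj₂ (incoherent⇒inner inc-x))) y∈) y≢x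
        x∈suf : x ∈ᵥ suf y R₁
        x∈suf = >⇒∈ᵥ-suf r₁ y∈R₁ (proj₁ (proj₁ (incoherent⇒inner inc-x))) y<x

    splice₁₂≢ : ∀ {R₁ R₂ x} → Incoherent R₁ R₂ x → R₁ ⟨ x ⟩ R₂ ≢ R₁
    splice₁₂≢ {R₁} {R₂} {x} inc eq =
      incoherent⇒suf≢ inc
        (trans (cong (suf x) (sym eq)) (suf-splice R₁ R₂ (proj₁ (proj₁ (incoherent⇒inner inc)))))

    splice₂₁≢ : ∀ {R₁ R₂ x} → Incoherent R₁ R₂ x → R₂ ⟨ x ⟩ R₁ ≢ R₁
    splice₂₁≢ {R₁} {R₂} {x} inc eq =
      incoherent⇒pre≢ inc
        (trans (cong (pre x) (sym eq)) (pre-splice R₂ R₁ (proj₁ (proj₂ (incoherent⇒inner inc)))))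

    IsClique : Pred Route 0ℓ → Set
    IsClique = Defs.IsClique G F

    IsMaximalClique : Pred Route 0ℓ → Set₁
    IsMaximalClique = Defs.IsMaximalClique G F

    ∈-maximal : ∀ {C W} → IsMaximalClique C → IsRoute W → (∀ Z → Z ∈ C → Coherent Z W) → W ∈ C
    ∈-maximal {C} {W} ((routes , coh) , maximal) rW cohW = maximal D (routesD , cohD) inj₁ (inj₂ refl)
      where
        D : Pred Route 0ℓ
        D R = R ∈ C ⊎ R ≡ W
        routesD : ∀ R → R ∈ D → IsRoute R
        routesD R (inj₁ R∈C)  = routes R R∈C
        routesD R (inj₂ refl) = rW
        cohD : ∀ R R′ → R ∈ D → R′ ∈ D → Coherent R R′
        cohD R R′ (inj₁ R∈C)  (inj₁ R′∈C) = coh R R′ R∈C R′∈C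
        cohD R R′ (inj₁ R∈C)  (inj₂ refl) = cohW R R∈C
        cohD R R′ (inj₂ refl) (inj₁ R′∈C) = coherent-sym (cohW R′ R′∈C)
        cohD R R′ (inj₂ refl) (inj₂ refl) = coherent-refl

    ∈-maximal-by-cases : ∀ {C R W} → IsMaximalClique C → R ∈ C → IsRoute W → Coherent W R →
                         (∀ Z → Z ∈ C → Z ≢ R → Coherent Z W) → W ∈ C
    ∈-maximal-by-cases {C} {R} {W} maximal R∈C rW cohW cohW′ = ∈-maximal maximal rW coherent
      where
        coherent : ∀ Z → Z ∈ C → Coherent Z W
        coherent Z Z∈C with List.≡-dec _≟_ Z R
        ... | yes refl = coherent-sym cohW
        ... | no Z≢R   = cohW′ Z Z∈C Z≢R

    module Splices {C R₁ R₂} (maximal : IsMaximalClique C) (R₁∈C : R₁ ∈ C) (r₂ : IsRoute R₂)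
                   (coh₂ : ∀ Z → Z ∈ C → Z ≢ R₁ → Coherent Z R₂) where

      route : ∀ Z → Z ∈ C → IsRoute Z
      route = proj₁ (proj₁ maximal)

      r₁ : IsRoute R₁
      r₁ = route R₁ R₁∈C

      cohC : ∀ Z → Z ∈ C → Coherent Z R₁
      cohC Z Z∈C = proj₂ (proj₁ maximal) Z R₁ Z∈C R₁∈C

      splice₁₂∈C-if-coherent : ∀ {x} → Incoherent R₁ R₂ x → Coherent (R₁ ⟨ x ⟩ R₂) R₁ → R₁ ⟨ x ⟩ R₂ ∈ C
      splice₁₂∈C-if-coherent {x} inc coh =
        ∈-maximal-by-cases maximal R₁∈C (splice-route r₁ r₂ x∈R₁ x∈R₂) coh
          (λ Z Z∈C Z≢R₁ → coherent-splice r₁ r₂ (route Z Z∈C) inc (cohC Z Z∈C) (coh₂ Z Z∈C Z≢R₁))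
        where
          x∈R₁ : x ∈ᵥ R₁
          x∈R₁ = proj₁ (proj₁ (incoherent⇒inner inc))
          x∈R₂ : x ∈ᵥ R₂
          x∈R₂ = proj₁ (proj₂ (incoherent⇒inner inc))

      splice₂₁∈C-if-coherent : ∀ {x} → Incoherent R₁ R₂ x → Coherent (R₂ ⟨ x ⟩ R₁) R₁ → R₂ ⟨ x ⟩ R₁ ∈ C
      splice₂₁∈C-if-coherent {x} inc coh =
        ∈-maximal-by-cases maximal R₁∈C (splice-route r₂ r₁ x∈R₂ x∈R₁) coh
          (λ Z Z∈C Z≢R₁ → coherent-splice r₂ r₁ (route Z Z∈C) (Sum.swap inc) (coh₂ Z Z∈C Z≢R₁) (cohC Z Z∈C))
        where
          x∈R₁ : x ∈ᵥ R₁
          x∈R₁ = proj₁ (proj₁ (incoherent⇒inner inc))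
          x∈R₂ : x ∈ᵥ R₂
          x∈R₂ = proj₁ (proj₂ (incoherent⇒inner inc))

      -- Induction on x from the sink backwards: an incoherence of R₁ ⟨ x ⟩ R₂ with R₁ lies at a later
      -- incoherence vertex y of R₁ and R₂, where R₁ ⟨ y ⟩ R₂ is already known to lie in C.
      splice₁₂-coherent : ∀ x → Incoherent R₁ R₂ x → Coherent (R₁ ⟨ x ⟩ R₂) R₁
      splice₁₂-coherent = All.wfRec >-wellFounded 0ℓ _ step
        where
          step : ∀ x → (∀ {y} → x < y → Incoherent R₁ R₂ y → Coherent (R₁ ⟨ y ⟩ R₂) R₁) →
                 Incoherent R₁ R₂ x → Coherent (R₁ ⟨ x ⟩ R₂) R₁
          step x ih inc-x y inc with splice₁₂-incoherent r₁ r₂ inc-x inc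
          ... | y∈ , inc-y = coh-y y (subst (λ W → Incoherent W R₁ y) same-splice inc)
            where
              coh-y : Coherent (R₁ ⟨ y ⟩ R₂) R₁
              coh-y = ih (∈ᵥ-suf⇒> r₂ (proj₁ (proj₂ (incoherent⇒inner inc-x))) y∈) inc-y
              splice-y∈C : R₁ ⟨ y ⟩ R₂ ∈ C
              splice-y∈C = splice₁₂∈C-if-coherent inc-y coh-y
              same-splice : R₁ ⟨ x ⟩ R₂ ≡ R₁ ⟨ y ⟩ R₂
              same-splice = splice₁₂-stable r₁ r₂ inc-x y∈ inc-y
                              (coherent-sym (coh₂ _ splice-y∈C (splice₁₂≢ inc-y)))

      splice₂₁-coherent : ∀ x → Incoherent R₁ R₂ x → Coherent (R₂ ⟨ x ⟩ R₁) R₁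
      splice₂₁-coherent = All.wfRec <-wellFounded 0ℓ _ step
        where
          step : ∀ x → (∀ {y} → y < x → Incoherent R₁ R₂ y → Coherent (R₂ ⟨ y ⟩ R₁) R₁) →
                 Incoherent R₁ R₂ x → Coherent (R₂ ⟨ x ⟩ R₁) R₁
          step x ih inc-x y inc with splice₂₁-incoherent r₁ r₂ inc-x inc
          ... | y∈ , y≢x , inc-y = coh-y y (subst (λ W → Incoherent W R₁ y) same-splice inc)
            where
              y<x : y < x
              y<x = Fin.≤∧≢⇒< (∈ᵥ-pre⇒≤ r₂ (proj₁ (proj₂ (incoherent⇒inner inc-x))) y∈) y≢x
              coh-y : Coherent (R₂ ⟨ y ⟩ R₁) R₁
              coh-y = ih y<x inc-y
              splice-y∈C : R₂ ⟨ y ⟩ R₁ ∈ C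
              splice-y∈C = splice₂₁∈C-if-coherent inc-y coh-y
              same-splice : R₂ ⟨ x ⟩ R₁ ≡ R₂ ⟨ y ⟩ R₁
              same-splice = splice₂₁-stable r₁ r₂ inc-x y∈ y≢x inc-y
                              (coherent-sym (coh₂ _ splice-y∈C (splice₂₁≢ inc-y)))

      splice₁₂∈C : ∀ {x} → Incoherent R₁ R₂ x → R₁ ⟨ x ⟩ R₂ ∈ C
      splice₁₂∈C inc = splice₁₂∈C-if-coherent inc (splice₁₂-coherent _ inc)

      splice₂₁∈C : ∀ {x} → Incoherent R₁ R₂ x → R₂ ⟨ x ⟩ R₁ ∈ C
      splice₂₁∈C inc = splice₂₁∈C-if-coherent inc (splice₂₁-coherent _ inc)

    InBetween : Route → Route → Vertex → Route → Set
    InBetween = Defs.InBetween G F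

    pre-suf-injective : ∀ {P Q v} → pre v P ≡ pre v Q → suf v P ≡ suf v Q → P ≡ Q
    pre-suf-injective {P} {Q} {v} eq₁ eq₂ = begin
      P                  ≡⟨ pre++suf v P ⟨
      pre v P ++ suf v P ≡⟨ cong₂ _++_ eq₁ eq₂ ⟩
      pre v Q ++ suf v Q ≡⟨ pre++suf v Q ⟩
      Q                  ∎
      where open ≡-Reasoning

    inBetween⇒≢ : ∀ {R₁ R₂ v R} → InBetween R₁ R₂ v R → R ≢ R₁
    inBetween⇒≢ (_ , inj₁ (R₁<ᴵR , _)) refl = BackLt-irrefl R₁<ᴵR
    inBetween⇒≢ (_ , inj₂ (_ , _ , _ , R<ᴼR₁)) refl = FwdLt-irrefl R<ᴼR₁

    inBetween⇒incoherent : ∀ {R₁ R₂ v R} → CW R₁ v R₂ → InBetween R₁ R₂ v R →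
                           Incoherent R R₁ v ⊎ Incoherent R R₂ v
    inBetween⇒incoherent (iR₁ , iR₂ , _ , R₂<ᴼR₁) (iR , inj₁ (R₁<ᴵR , R<ᴵR₂ , R₂≤ᴼR , R≤ᴼR₁))
      with R≤ᴼR₁ | R₂≤ᴼR
    ... | inj₁ R<ᴼR₁ | _          = inj₁ (inj₂ (iR₁ , iR , R₁<ᴵR , R<ᴼR₁))
    ... | inj₂ _     | inj₁ R₂<ᴼR = inj₂ (inj₁ (iR , iR₂ , R<ᴵR₂ , R₂<ᴼR))
    ... | inj₂ eq₁   | inj₂ eq₂   = ⊥-elim (FwdLt-irrefl (<O-respˡ (trans eq₂ eq₁) R₂<ᴼR₁))
    inBetween⇒incoherent (iR₁ , iR₂ , R₁<ᴵR₂ , _) (iR , inj₂ (R₁≤ᴵR , R≤ᴵR₂ , R₂<ᴼR , R<ᴼR₁))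
      with R₁≤ᴵR | R≤ᴵR₂
    ... | inj₁ R₁<ᴵR | _          = inj₁ (inj₂ (iR₁ , iR , R₁<ᴵR , R<ᴼR₁))
    ... | inj₂ _     | inj₁ R<ᴵR₂ = inj₂ (inj₁ (iR , iR₂ , R<ᴵR₂ , R₂<ᴼR))
    ... | inj₂ eq₁   | inj₂ eq₂   = ⊥-elim (BackLt-irrefl (<I-respʳ (sym (trans eq₁ eq₂)) R₁<ᴵR₂))

    module Exchange {C₁ R₁ R₂ v} (maximal : IsMaximalClique C₁) (R₁∈C₁ : R₁ ∈ C₁) (r₂ : IsRoute R₂)
                    (cw : CW R₁ v R₂) where

      C₂ : Pred Route 0ℓ
      C₂ = Defs.exchange G C₁ R₁ R₂

      A B : Route
      A = R₁ ⟨ v ⟩ R₂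
      B = R₂ ⟨ v ⟩ R₁

      NoneInBetween : Set
      NoneInBetween = ¬ (∃ λ R → R ∈ C₁ × InBetween R₁ R₂ v R)

      r₁ : IsRoute R₁
      r₁ = proj₁ (proj₁ maximal) R₁ R₁∈C₁

      cohC₁ : ∀ Z Z′ → Z ∈ C₁ → Z′ ∈ C₁ → Coherent Z Z′
      cohC₁ = proj₂ (proj₁ maximal)

      iR₁ : Inner v R₁
      iR₁ = proj₁ cw
      iR₂ : Inner v R₂
      iR₂ = proj₁ (proj₂ cw)
      R₁<ᴵR₂ : R₁ <I[ v ] R₂
      R₁<ᴵR₂ = proj₁ (proj₂ (proj₂ cw))
      R₂<ᴼR₁ : R₂ <O[ v ] R₁
      R₂<ᴼR₁ = proj₂ (proj₂ (proj₂ cw))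
      v∈R₁ : v ∈ᵥ R₁
      v∈R₁ = proj₁ iR₁
      v∈R₂ : v ∈ᵥ R₂
      v∈R₂ = proj₁ iR₂
      v≢t : v ≢ t
      v≢t = proj₂ iR₁

      pre-A : pre v A ≡ pre v R₁
      pre-A = pre-splice R₁ R₂ v∈R₁
      suf-A : suf v A ≡ suf v R₂
      suf-A = suf-splice R₁ R₂ v∈R₁
      pre-B : pre v B ≡ pre v R₂
      pre-B = pre-splice R₂ R₁ v∈R₂
      suf-B : suf v B ≡ suf v R₁
      suf-B = suf-splice R₂ R₁ v∈R₂

      iA : Inner v A
      iA = ∈ᵥ-splice R₁ R₂ v∈R₁ , v≢t
      iB : Inner v B
      iB = ∈ᵥ-splice R₂ R₁ v∈R₂ , v≢t

      exchange-maximal⇒ : IsMaximalClique C₂ → (A ∈ C₁ × A ∈ C₂ × B ∈ C₁ × B ∈ C₂) × NoneInBetween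
      exchange-maximal⇒ ((_ , coh₂) , _) =
        (A∈C₁ , inj₁ (A∈C₁ , splice₁₂≢ (inj₁ cw)) , B∈C₁ , inj₁ (B∈C₁ , splice₂₁≢ (inj₁ cw))) , none
        where
          cohR₂ : ∀ Z → Z ∈ C₁ → Z ≢ R₁ → Coherent Z R₂
          cohR₂ Z Z∈C₁ Z≢R₁ = coh₂ Z R₂ (inj₁ (Z∈C₁ , Z≢R₁)) (inj₂ refl)
          open Splices maximal R₁∈C₁ r₂ cohR₂ using (splice₁₂∈C; splice₂₁∈C)
          A∈C₁ : A ∈ C₁
          A∈C₁ = splice₁₂∈C (inj₁ cw)
          B∈C₁ : B ∈ C₁
          B∈C₁ = splice₂₁∈C (inj₁ cw)
          none : NoneInBetween
          none (R , R∈C₁ , between) =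
            [ cohC₁ R R₁ R∈C₁ R₁∈C₁ v , cohR₂ R R∈C₁ (inBetween⇒≢ {R₂ = R₂} between) v ]′
              (inBetween⇒incoherent cw between)

      module Conditions (A∈C₁ : A ∈ C₁) (B∈C₁ : B ∈ C₁) (none : NoneInBetween) where

        A∈C₂ : A ∈ C₂
        A∈C₂ = inj₁ (A∈C₁ , splice₁₂≢ (inj₁ cw))

        B∈C₂ : B ∈ C₂
        B∈C₂ = inj₁ (B∈C₁ , splice₂₁≢ (inj₁ cw))

        ¬beyond-R₁ : ∀ {X} → IsRoute X → X ∈ C₁ → X ≢ R₁ → Inner v X → X <I[ v ] R₂ → R₂ <O[ v ] X →
                     ¬ R₁ ≤I[ v ] X
        ¬beyond-R₁ {X} rX X∈C₁ X≢R₁ iX X<ᴵR₂ R₂<ᴼX R₁≤ᴵX with compareᴼ rX r₁ (proj₁ iX) v∈R₁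
        ... | inj₁ X<ᴼR₁ = none (X , X∈C₁ , iX , inj₂ (R₁≤ᴵX , inj₁ X<ᴵR₂ , R₂<ᴼX , X<ᴼR₁))
        ... | inj₂ (inj₂ R₁<ᴼX) =
              cohC₁ X B X∈C₁ B∈C₁ v
                (inj₁ (iX , iB , <I-respʳ (sym pre-B) X<ᴵR₂ , <O-respˡ (sym suf-B) R₁<ᴼX))
        ... | inj₂ (inj₁ same-suf) with R₁≤ᴵX
        ...   | inj₁ R₁<ᴵX    = none (X , X∈C₁ , iX , inj₁ (R₁<ᴵX , X<ᴵR₂ , inj₁ R₂<ᴼX , inj₂ same-suf))
        ...   | inj₂ same-pre = X≢R₁ (pre-suf-injective (sym same-pre) same-suf)

        ¬cw-X-R₂ : ∀ {X} → IsRoute X → X ∈ C₁ → X ≢ R₁ → ¬ CW X v R₂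
        ¬cw-X-R₂ {X} rX X∈C₁ X≢R₁ (iX , _ , X<ᴵR₂ , R₂<ᴼX) with compareᴵ rX r₁ (proj₁ iX) v∈R₁
        ... | inj₁ X<ᴵR₁ =
              cohC₁ X A X∈C₁ A∈C₁ v
                (inj₁ (iX , iA , <I-respʳ (sym pre-A) X<ᴵR₁ , <O-respˡ (sym suf-A) R₂<ᴼX))
        ... | inj₂ (inj₁ same-pre) = ¬beyond-R₁ rX X∈C₁ X≢R₁ iX X<ᴵR₂ R₂<ᴼX (inj₂ (sym same-pre))
        ... | inj₂ (inj₂ R₁<ᴵX)    = ¬beyond-R₁ rX X∈C₁ X≢R₁ iX X<ᴵR₂ R₂<ᴼX (inj₁ R₁<ᴵX)

        ¬cw-R₂-X : ∀ {X} → X ∈ C₁ → ¬ CW R₂ v X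
        ¬cw-R₂-X {X} X∈C₁ (_ , iX , R₂<ᴵX , X<ᴼR₂) =
          cohC₁ X A X∈C₁ A∈C₁ v
            (inj₂ (iA , iX , <I-respˡ (sym pre-A) (BackLt-trans R₁<ᴵR₂ R₂<ᴵX) , <O-respʳ (sym suf-A) X<ᴼR₂))

        coherent-R₂ : ∀ {X} → X ∈ C₁ → X ≢ R₁ → Coherent X R₂
        coherent-R₂ {X} X∈C₁ X≢R₁ u inc =
          [ ¬cw-X-R₂ rX X∈C₁ X≢R₁ , ¬cw-R₂-X X∈C₁ ]′
            (incoherent-at-junction r₂ (splice-route r₁ r₂ v∈R₁ v∈R₂) rX iR₂ (sym pre-B) (sym suf-A)
               (proj₁ iA) (cohC₁ X B X∈C₁ B∈C₁) (cohC₁ X A X∈C₁ A∈C₁) inc)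
          where
            rX : IsRoute X
            rX = proj₁ (proj₁ maximal) X X∈C₁

        ¬cw-X-R₁ : ∀ {X} → (∀ Z → Z ∈ C₂ → Coherent X Z) → ¬ CW X v R₁
        ¬cw-X-R₁ cohX (iX , _ , X<ᴵR₁ , R₁<ᴼX) =
          cohX B B∈C₂ v
            (inj₁ (iX , iB , <I-respʳ (sym pre-B) (BackLt-trans X<ᴵR₁ R₁<ᴵR₂) , <O-respˡ (sym suf-B) R₁<ᴼX))

        -- Here X is coherent with everything in C₁ except R₁, so the splices of R₁ and X at v lie in C₁.
        ¬cw-R₁-X : ∀ {X} → IsRoute X → (∀ Z → Z ∈ C₂ → Coherent X Z) → X ≢ R₂ → ¬ CW R₁ v X
        ¬cw-R₁-X {X} rX cohX X≢R₂ (_ , iX , R₁<ᴵX , X<ᴼR₁) = compare-in (compareᴵ rX r₂ v∈X v∈R₂)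
          where
            v∈X : v ∈ᵥ X
            v∈X = proj₁ iX
            inc : Incoherent R₁ X v
            inc = inj₁ (iR₁ , iX , R₁<ᴵX , X<ᴼR₁)
            open Splices maximal R₁∈C₁ rX (λ Z Z∈C₁ Z≢R₁ → coherent-sym (cohX Z (inj₁ (Z∈C₁ , Z≢R₁))))
              using (splice₁₂∈C; splice₂₁∈C)
            A′ B′ : Route
            A′ = R₁ ⟨ v ⟩ X
            B′ = X ⟨ v ⟩ R₁
            compare-out : pre v X ≡ pre v R₂ → X <O[ v ] R₂ ⊎ suf v X ≡ suf v R₂ ⊎ R₂ <O[ v ] X → ⊥
            compare-out _ (inj₁ X<ᴼR₂) =
              cohX A A∈C₂ v (inj₂ (iA , iX , <I-respˡ (sym pre-A) R₁<ᴵX , <O-respʳ (sym suf-A) X<ᴼR₂))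
            compare-out same-pre (inj₂ (inj₁ same-suf)) = X≢R₂ (pre-suf-injective same-pre same-suf)
            compare-out _ (inj₂ (inj₂ R₂<ᴼX)) =
              none (A′ , splice₁₂∈C inc , (∈ᵥ-splice R₁ X v∈R₁ , v≢t) ,
                    inj₂ (inj₂ (sym pre-A′) , inj₁ (<I-respˡ (sym pre-A′) R₁<ᴵR₂) ,
                          <O-respʳ (sym suf-A′) R₂<ᴼX , <O-respˡ (sym suf-A′) X<ᴼR₁))
              where
                pre-A′ : pre v A′ ≡ pre v R₁
                pre-A′ = pre-splice R₁ X v∈R₁
                suf-A′ : suf v A′ ≡ suf v X
                suf-A′ = suf-splice R₁ X v∈R₁
            compare-in : X <I[ v ] R₂ ⊎ pre v X ≡ pre v R₂ ⊎ R₂ <I[ v ] X → ⊥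
            compare-in (inj₁ X<ᴵR₂) =
              none (B′ , splice₂₁∈C inc , (∈ᵥ-splice X R₁ v∈X , v≢t) ,
                    inj₁ (<I-respʳ (sym pre-B′) R₁<ᴵX , <I-respˡ (sym pre-B′) X<ᴵR₂ ,
                          inj₁ (<O-respʳ (sym suf-B′) R₂<ᴼR₁) , inj₂ suf-B′))
              where
                pre-B′ : pre v B′ ≡ pre v X
                pre-B′ = pre-splice X R₁ v∈X
                suf-B′ : suf v B′ ≡ suf v R₁
                suf-B′ = suf-splice X R₁ v∈X
            compare-in (inj₂ (inj₁ same-pre)) = compare-out same-pre (compareᴼ rX r₂ v∈X v∈R₂)
            compare-in (inj₂ (inj₂ R₂<ᴵX)) =
              cohX B B∈C₂ v (inj₂ (iB , iX , <I-respˡ (sym pre-B) R₂<ᴵX , <O-respʳ (sym suf-B) X<ᴼR₁))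

        coherent-R₁ : ∀ {X} → IsRoute X → (∀ Z → Z ∈ C₂ → Coherent X Z) → X ≢ R₂ → Coherent X R₁
        coherent-R₁ rX cohX X≢R₂ u inc =
          [ ¬cw-X-R₁ cohX , ¬cw-R₁-X rX cohX X≢R₂ ]′
            (incoherent-at-junction r₁ (splice-route r₂ r₁ v∈R₂ v∈R₁) rX iR₁ (sym pre-A) (sym suf-B)
               (proj₁ iB) (cohX A A∈C₂) (cohX B B∈C₂) inc)

        clique₂ : IsClique C₂
        clique₂ = routes , coherent
          where
            routes : ∀ R → R ∈ C₂ → IsRoute R
            routes R (inj₁ (R∈C₁ , _)) = proj₁ (proj₁ maximal) R R∈C₁
            routes R (inj₂ refl)       = r₂
            coherent : ∀ R R′ → R ∈ C₂ → R′ ∈ C₂ → Coherent R R′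
            coherent R R′ (inj₁ (R∈C₁ , _))    (inj₁ (R′∈C₁ , _))    = cohC₁ R R′ R∈C₁ R′∈C₁
            coherent R R′ (inj₁ (R∈C₁ , R≢R₁)) (inj₂ refl)           = coherent-R₂ R∈C₁ R≢R₁
            coherent R R′ (inj₂ refl)           (inj₁ (R′∈C₁ , R′≢R₁)) =
              coherent-sym (coherent-R₂ R′∈C₁ R′≢R₁)
            coherent R R′ (inj₂ refl)           (inj₂ refl)           = coherent-refl

        maximal₂ : ∀ D → IsClique D → C₂ ⊆ D → D ⊆ C₂
        maximal₂ D (routesD , cohD) C₂⊆D {X} X∈D with List.≡-dec _≟_ X R₂
        ... | yes X≡R₂ = inj₂ X≡R₂
        ... | no X≢R₂  = inj₁ (∈-maximal-by-cases maximal R₁∈C₁ rX (coherent-R₁ rX cohX X≢R₂)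
                                 (λ Z Z∈C₁ Z≢R₁ → coherent-sym (cohX Z (inj₁ (Z∈C₁ , Z≢R₁)))) , X≢R₁)
          where
            rX : IsRoute X
            rX = routesD X X∈D
            cohX : ∀ Z → Z ∈ C₂ → Coherent X Z
            cohX Z Z∈C₂ = cohD X Z X∈D (C₂⊆D Z∈C₂)
            X≢R₁ : X ≢ R₁
            X≢R₁ refl = cohX R₂ (inj₂ refl) v (inj₁ cw)

      exchange-maximal⇐ : (A ∈ C₁ × A ∈ C₂ × B ∈ C₁ × B ∈ C₂) × NoneInBetween → IsMaximalClique C₂
      exchange-maximal⇐ ((A∈C₁ , _ , B∈C₁ , _) , none) = clique₂ , maximal₂
        where open Conditions A∈C₁ B∈C₁ none

open import Defs

proposition1p11 : (G : FlowGraph) (F : Framing G) (C₁ : Pred (Route G) 0ℓ)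
    (R₁ R₂ : Route G) (v : Vertex G) →
    IsMaximalClique G F C₁ → R₁ ∈ C₁ → IsRoute G R₂ → CW G F R₁ v R₂ →
    (IsMaximalClique G F (exchange G C₁ R₁ R₂)
      ⇔ (((_⟨_⟩_ G R₁ v R₂) ∈ C₁ × (_⟨_⟩_ G R₁ v R₂) ∈ exchange G C₁ R₁ R₂
          × (_⟨_⟩_ G R₂ v R₁) ∈ C₁ × (_⟨_⟩_ G R₂ v R₁) ∈ exchange G C₁ R₁ R₂)
        × ¬ (∃ λ R → R ∈ C₁ × InBetween G F R₁ R₂ v R)))
proposition1p11 G F C₁ R₁ R₂ v maximal R₁∈C₁ r₂ cw = mk⇔ exchange-maximal⇒ exchange-maximal⇐
  where open Splicing.Exchange G F maximal R₁∈C₁ r₂ cw
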